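{- Let $D$ be a finite digraph without loops or two-cycles with arc-weighting $w: A(D)\to[0,\infty)$, and let $u\ne v$ be vertices such that for every vertex $x$, if $x\to u$ is an arc of nonzero weight then $x\to v$ is also an arc (possibly of weight zero). Form the arc-weighted digraph $D'$ by deleting $u$ (with all its incident arcs) and, for every $x$ with $x\to u$ an arc of nonzero weight, increasing the weight of the arc $x\to v$ by $w(xu)$. Then $\delta^{D'}_y \le \delta^D_y$ for every vertex $y$ of $D'$.
   Context: For vertices $a,b$ of a digraph, $b$ is an $n$th out-neighbor of $a$ if the shortest directed path from $a$ to $b$ has exactly $n$ arcs; $N_n^+(a)$ is the set of $n$th out-neighbors. For an arc-weighted digraph $(D,w)$ and a vertex $y$: $\alpha^D_y=\sum_{z\in N_1^+(y)} w(yz)$. For a vertex $s$ that is the end of some directed path $y\to z\to s$ of length 2, $\beta_y(s)=\max\big(\{0\}\cup\{w(zs)-w(ys) : y\to z\to s\}\big)$, with $w(ys)=0$ if $ys$ is not an arc; $\beta^D_y=\sum_s\beta_y(s)$ over all such $s$, and $\delta^D_y=\beta^D_y-\alpha^D_y$. An arc of weight zero still counts as an arc.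
   Formalization: The arc weights take values in the nonnegative rationals instead of $[0,\infty)$. -}

module Defs where

open import Data.Nat using (ℕ; zero; suc)
open import Data.Fin using (Fin; zero; suc; punchIn; _≟_)
open import Data.Bool using (Bool; true; false; if_then_else_; _∧_; _∨_; not)
open import Data.Rational using (ℚ; 0ℚ; _+_; _-_; _⊔_; _≤_)
open import Relation.Nullary.Decidable using (⌊_⌋)
open import Relation.Binary.PropositionalEquality using (_≡_; _≢_)

-- Finite digraph on vertex set Fin n with an arc-weighting.
-- arc x y = true  iff  x → y is an arc.  The weight w x y is only
-- meaningful when x → y is an arc (see wt).
record WDigraph (n : ℕ) : Set where
  field
    arc : Fin n → Fin n → Bool
    w   : Fin n → Fin n → ℚ
open WDigraph public

NoLoops : ∀ {n} → WDigraph n → Set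
NoLoops D = ∀ x → arc D x x ≡ false

NoTwoCycles : ∀ {n} → WDigraph n → Set
NoTwoCycles D = ∀ x y → arc D x y ≡ true → arc D y x ≡ false

NonNegWeights : ∀ {n} → WDigraph n → Set
NonNegWeights D = ∀ x y → arc D x y ≡ true → 0ℚ ≤ w D x y

wt : ∀ {n} → WDigraph n → Fin n → Fin n → ℚ
wt D x y = if arc D x y then w D x y else 0ℚ

Σℚ : ∀ n → (Fin n → ℚ) → ℚ
Σℚ zero    f = 0ℚ
Σℚ (suc n) f = f zero + Σℚ n (λ i → f (suc i))

anyFin : ∀ n → (Fin n → Bool) → Bool
anyFin zero    p = false
anyFin (suc n) p = p zero ∨ anyFin n (λ i → p (suc i))

max0 : ∀ n → (Fin n → Bool) → (Fin n → ℚ) → ℚ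
max0 zero    P f = 0ℚ
max0 (suc n) P f = (if P zero then f zero else 0ℚ) ⊔ max0 n (λ i → P (suc i)) (λ i → f (suc i))

-- z ∈ N₁⁺(y): shortest path from y to z has exactly one arc,
-- i.e. y ≠ z and y → z is an arc
isN1 : ∀ {n} → WDigraph n → Fin n → Fin n → Bool
isN1 D y z = not ⌊ y ≟ z ⌋ ∧ arc D y z

αD : ∀ {n} → WDigraph n → Fin n → ℚ
αD {n} D y = Σℚ n (λ z → if isN1 D y z then w D y z else 0ℚ)

path2 : ∀ {n} → WDigraph n → Fin n → Fin n → Fin n → Bool
path2 D y z s = arc D y z ∧ arc D z s
              ∧ not ⌊ y ≟ z ⌋ ∧ not ⌊ z ≟ s ⌋ ∧ not ⌊ y ≟ s ⌋

isEnd2 : ∀ {n} → WDigraph n → Fin n → Fin n → Bool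
isEnd2 {n} D y s = anyFin n (λ z → path2 D y z s)

βs : ∀ {n} → WDigraph n → Fin n → Fin n → ℚ
βs {n} D y s = max0 n (λ z → path2 D y z s) (λ z → w D z s - wt D y s)

βD : ∀ {n} → WDigraph n → Fin n → ℚ
βD {n} D y = Σℚ n (λ s → if isEnd2 D y s then βs D y s else 0ℚ)

δD : ∀ {n} → WDigraph n → Fin n → ℚ
δD D y = βD D y - αD D y

Absorbs : ∀ {n} → WDigraph n → Fin n → Fin n → Set
Absorbs D u v = ∀ x → arc D x u ≡ true → w D x u ≢ 0ℚ → arc D x v ≡ true

-- D' : delete u (vertices of D' are Fin m, embedded via punchIn u),
-- and for every x with x → u an arc of nonzero weight, increase w(xv)
-- by w(xu).  (Adding w(xu) when it is zero changes nothing.)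
contract : ∀ {m} → WDigraph (suc m) → Fin (suc m) → Fin (suc m) → WDigraph m
contract D u v = record
  { arc = λ i j → arc D (punchIn u i) (punchIn u j)
  ; w   = λ i j → w D (punchIn u i) (punchIn u j)
                  + (if ⌊ punchIn u j ≟ v ⌋ ∧ arc D (punchIn u i) u
                       then w D (punchIn u i) u else 0ℚ)
  }

{-# OPTIONS --safe #-}
-- Contracting u into v keeps the out-arcs of y and redirects the weight of y → u onto
-- y → v, so α does not decrease: if y → v is absent, then w(yu) = 0 by hypothesis.  For
-- β, a path y → z → s of D' is a path of D with the same weights unless s = v, and then
-- its excess w'(zv) − w'(yv) splits as (w(zv) − w(yv)) + (w(zu) − w(yu)), the second
-- part being bounded by βᵧ(u) through the path y → z → u.  Hence β'ᵧ(s) ≤ βᵧ(s) for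
-- s ≠ v and β'ᵧ(v) ≤ βᵧ(v) + βᵧ(u), and summing gives β' ≤ β.
module Submission where

open import Defs
open import Data.Nat using (ℕ; zero; suc)
open import Data.Fin using (Fin; zero; suc; punchIn; punchOut; _≟_)
open import Data.Fin.Properties using (punchIn-injective; punchInᵢ≢i; punchIn-punchOut)
open import Data.Rational using (ℚ; 0ℚ; _≤_; _+_; _-_; -_)
open import Data.Rational.Properties renaming (_≟_ to _≟ℚ_)
open import Data.Rational.Solver using (module +-*-Solver)
open import Data.Bool using (true; false; if_then_else_)
open import Data.Bool.Properties using (∨-zeroʳ)
open import Relation.Nullary using (yes; no)
open import Relation.Nullary.Decidable using (⌊_⌋; isYes≗does; dec-true; dec-false)
open import Relation.Binary.PropositionalEquality
open import Function using (_∘′_)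

private
  open +-*-Solver

  +-swapʳ : ∀ a b c → (a + b) + c ≡ (a + c) + b
  +-swapʳ = solve 3 (λ a b c → (a :+ b) :+ c := (a :+ c) :+ b) refl

  +-swapˡ : ∀ a b c → a + (b + c) ≡ b + (a + c)
  +-swapˡ = solve 3 (λ a b c → a :+ (b :+ c) := b :+ (a :+ c)) refl

  +-‿-interchange : ∀ a b c d → (a + b) - (c + d) ≡ (a - c) + (b - d)
  +-‿-interchange = solve 4 (λ a b c d → (a :+ b) :- (c :+ d) := (a :- c) :+ (b :- d)) refl

0≤+ : ∀ {p q} → 0ℚ ≤ p → 0ℚ ≤ q → 0ℚ ≤ p + q
0≤+ 0≤p 0≤q = ≤-trans (≤-reflexive (sym (+-identityʳ 0ℚ))) (+-mono-≤ 0≤p 0≤q)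

Σℚ-punchIn : ∀ n (k : Fin (suc n)) (f : Fin (suc n) → ℚ) →
             Σℚ (suc n) f ≡ f k + Σℚ n (λ i → f (punchIn k i))
Σℚ-punchIn n       zero    f = refl
Σℚ-punchIn (suc n) (suc k) f =
  trans (cong (f zero +_) (Σℚ-punchIn n k (λ i → f (suc i)))) (+-swapˡ (f zero) (f (suc k)) _)

Σℚ-mono : ∀ n (f g : Fin n → ℚ) → (∀ i → f i ≤ g i) → Σℚ n f ≤ Σℚ n g
Σℚ-mono zero    f g f≤g = ≤-refl
Σℚ-mono (suc n) f g f≤g = +-mono-≤ (f≤g zero) (Σℚ-mono n _ _ (λ i → f≤g (suc i)))

Σℚ-mono-except : ∀ n (k : Fin n) (f g : Fin n → ℚ) (c d : ℚ) → f k + c ≤ g k + d →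
                 (∀ j → j ≢ k → f j ≤ g j) → Σℚ n f + c ≤ Σℚ n g + d
Σℚ-mono-except (suc n) k f g c d at-k off-k = begin
  Σℚ (suc n) f + c                         ≡⟨ cong (_+ c) (Σℚ-punchIn n k f) ⟩
  (f k + Σℚ n (λ i → f (punchIn k i))) + c ≡⟨ +-swapʳ (f k) _ c ⟩
  (f k + c) + Σℚ n (λ i → f (punchIn k i)) ≤⟨ +-mono-≤ at-k (Σℚ-mono n _ _ λ i → off-k _ (punchInᵢ≢i k i)) ⟩
  (g k + d) + Σℚ n (λ i → g (punchIn k i)) ≡⟨ +-swapʳ (g k) _ d ⟨
  (g k + Σℚ n (λ i → g (punchIn k i))) + d ≡⟨ cong (_+ d) (Σℚ-punchIn n k g) ⟨
  Σℚ (suc n) g + d                         ∎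
  where open ≤-Reasoning

0≤max0 : ∀ n P f → 0ℚ ≤ max0 n P f
0≤max0 zero    P f = ≤-refl
0≤max0 (suc n) P f =
  p≤q⇒p≤r⊔q (if P zero then f zero else 0ℚ) (0≤max0 n (λ i → P (suc i)) (λ i → f (suc i)))

max0-upper : ∀ n P f i → P i ≡ true → f i ≤ max0 n P f
max0-upper (suc n) P f zero    Pi rewrite Pi = p≤p⊔q (f zero) _
max0-upper (suc n) P f (suc i) Pi =
  p≤q⇒p≤r⊔q (if P zero then f zero else 0ℚ) (max0-upper n (λ i → P (suc i)) (λ i → f (suc i)) i Pi)

max0-lub : ∀ n P f c → 0ℚ ≤ c → (∀ i → P i ≡ true → f i ≤ c) → max0 n P f ≤ c
max0-lub zero    P f c 0≤c f≤c = 0≤c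
max0-lub (suc n) P f c 0≤c f≤c =
  ⊔-lub head (max0-lub n (λ i → P (suc i)) (λ i → f (suc i)) c 0≤c (λ i → f≤c (suc i)))
  where
  head : (if P zero then f zero else 0ℚ) ≤ c
  head with P zero in P0
  ... | true  = f≤c zero P0
  ... | false = 0≤c

anyFin-witness : ∀ n p i → p i ≡ true → anyFin n p ≡ true
anyFin-witness (suc n) p zero    pᵢ rewrite pᵢ = refl
anyFin-witness (suc n) p (suc i) pᵢ rewrite anyFin-witness n (λ j → p (suc j)) i pᵢ = ∨-zeroʳ (p zero)

⌊≟⌋-true : ∀ {n} {i j : Fin n} → i ≡ j → ⌊ i ≟ j ⌋ ≡ true
⌊≟⌋-true {i = i} {j} i≡j = trans (isYes≗does (i ≟ j)) (dec-true (i ≟ j) i≡j)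

⌊≟⌋-false : ∀ {n} {i j : Fin n} → i ≢ j → ⌊ i ≟ j ⌋ ≡ false
⌊≟⌋-false {i = i} {j} i≢j = trans (isYes≗does (i ≟ j)) (dec-false (i ≟ j) i≢j)

⌊punchIn≟punchIn⌋ : ∀ {n} (u : Fin (suc n)) (i j : Fin n) →
                    ⌊ punchIn u i ≟ punchIn u j ⌋ ≡ ⌊ i ≟ j ⌋
⌊punchIn≟punchIn⌋ u i j with i ≟ j
... | yes i≡j = ⌊≟⌋-true (cong (punchIn u) i≡j)
... | no  i≢j = ⌊≟⌋-false (i≢j ∘′ punchIn-injective u i j)

module _ {n : ℕ} (D : WDigraph n) where

  α-summand : Fin n → Fin n → ℚ
  α-summand y z = if isN1 D y z then w D y z else 0ℚ

  β-summand : Fin n → Fin n → ℚ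
  β-summand y s = if isEnd2 D y s then βs D y s else 0ℚ

  α-summand-≢ : ∀ {y z} → y ≢ z → α-summand y z ≡ wt D y z
  α-summand-≢ y≢z rewrite ⌊≟⌋-false y≢z = refl

  isN1-false⇒¬arc : NoLoops D → ∀ {y z} → isN1 D y z ≡ false → arc D y z ≡ false
  isN1-false⇒¬arc noLoops {y} {z} ¬N1 with y ≟ z
  ... | yes refl = noLoops y
  ... | no _     = ¬N1

  wt-absorbed : ∀ {u v} → Absorbs D u v → ∀ {x} → arc D x v ≡ false → wt D x u ≡ 0ℚ
  wt-absorbed {u} absorbs {x} ¬xv with arc D x u in xu
  ... | false = refl
  ... | true with w D x u ≟ℚ 0ℚ
  ...   | yes w≡0 = w≡0
  ...   | no  w≢0 with trans (sym (absorbs x xu w≢0)) ¬xv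
  ...     | ()

  0≤wt : NonNegWeights D → ∀ y z → 0ℚ ≤ wt D y z
  0≤wt nonNeg y z with arc D y z in yz
  ... | true  = nonNeg y z yz
  ... | false = ≤-refl

  0≤β-summand : ∀ y s → 0ℚ ≤ β-summand y s
  0≤β-summand y s with isEnd2 D y s
  ... | true  = 0≤max0 n _ _
  ... | false = ≤-refl

  β-summand-≥ : ∀ {y z s} → path2 D y z s ≡ true → w D z s - wt D y s ≤ β-summand y s
  β-summand-≥ {y} {z} {s} yzs
    rewrite anyFin-witness n (λ z → path2 D y z s) z yzs =
    max0-upper n (λ z → path2 D y z s) (λ z → w D z s - wt D y s) z yzs

  β-summand-lub : ∀ {y s c} → 0ℚ ≤ c →
                  (∀ z → path2 D y z s ≡ true → w D z s - wt D y s ≤ c) → β-summand y s ≤ c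
  β-summand-lub {y} {s} {c} 0≤c bound with isEnd2 D y s
  ... | true  = max0-lub n _ _ c 0≤c bound
  ... | false = 0≤c

  path2-retarget : ∀ {y z t s} → path2 D y z t ≡ true → arc D z s ≡ true → z ≢ s → y ≢ s →
                   path2 D y z s ≡ true
  path2-retarget {y} {z} {t} {s} yzt zs z≢s y≢s
    rewrite zs | ⌊≟⌋-false z≢s | ⌊≟⌋-false y≢s
    with arc D y z | arc D z t | y ≟ z | yzt
  ... | true | true | no _ | _ = refl

  β-summand-≥-wt : NonNegWeights D → ∀ {y z t s} → path2 D y z t ≡ true → z ≢ s → y ≢ s →
                   wt D z s - wt D y s ≤ β-summand y s
  β-summand-≥-wt nonNeg {y} {z} {t} {s} yzt z≢s y≢s with arc D z s in zs
  ... | true  = β-summand-≥ (path2-retarget yzt zs z≢s y≢s)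
  ... | false = begin
    0ℚ - wt D y s ≡⟨ +-identityˡ _ ⟩
    - wt D y s    ≤⟨ neg-antimono-≤ (0≤wt nonNeg y s) ⟩
    - 0ℚ          ≤⟨ 0≤β-summand y s ⟩
    β-summand y s ∎
    where open ≤-Reasoning

module Contraction {m : ℕ} (D : WDigraph (suc m)) (u v : Fin (suc m)) where

  private
    D′ : WDigraph m
    D′ = contract D u v

    π : Fin m → Fin (suc m)
    π = punchIn u

  isN1-contract : ∀ y z → isN1 D′ y z ≡ isN1 D (π y) (π z)
  isN1-contract y z rewrite ⌊punchIn≟punchIn⌋ u y z = refl

  path2-contract : ∀ y z s → path2 D′ y z s ≡ path2 D (π y) (π z) (π s)
  path2-contract y z s
    rewrite ⌊punchIn≟punchIn⌋ u y z | ⌊punchIn≟punchIn⌋ u z s | ⌊punchIn≟punchIn⌋ u y s = refl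

  w-contract-≢ : ∀ a b → π b ≢ v → w D′ a b ≡ w D (π a) (π b)
  w-contract-≢ a b πb≢v rewrite ⌊≟⌋-false πb≢v = +-identityʳ _

  w-contract-≡ : ∀ a b → π b ≡ v → w D′ a b ≡ w D (π a) (π b) + wt D (π a) u
  w-contract-≡ a b πb≡v rewrite ⌊≟⌋-true πb≡v = refl

  wt-contract-≢ : ∀ a b → π b ≢ v → wt D′ a b ≡ wt D (π a) (π b)
  wt-contract-≢ a b πb≢v = cong (if arc D (π a) (π b) then_else 0ℚ) (w-contract-≢ a b πb≢v)

  wt-contract-≡ : Absorbs D u v → ∀ a b → π b ≡ v →
                  wt D′ a b ≡ wt D (π a) (π b) + wt D (π a) u
  wt-contract-≡ absorbs a b πb≡v with arc D (π a) (π b) in ab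
  ... | true  = w-contract-≡ a b πb≡v
  ... | false = begin
    0ℚ                  ≡⟨ +-identityʳ 0ℚ ⟨
    0ℚ + 0ℚ             ≡⟨ cong (0ℚ +_) (wt-absorbed D absorbs (subst (λ t → arc D (π a) t ≡ false) πb≡v ab)) ⟨
    0ℚ + wt D (π a) u   ∎
    where open ≡-Reasoning

  α-summand-contract-≢ : ∀ y z → π z ≢ v → α-summand D′ y z ≡ α-summand D (π y) (π z)
  α-summand-contract-≢ y z πz≢v =
    cong₂ (λ b x → if b then x else 0ℚ) (isN1-contract y z) (w-contract-≢ y z πz≢v)

  α-summand-contract-≡ : NoLoops D → Absorbs D u v → ∀ y z → π z ≡ v →
                         α-summand D′ y z ≡ α-summand D (π y) (π z) + wt D (π y) u
  α-summand-contract-≡ noLoops absorbs y z πz≡v =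
    trans (cong₂ (λ b x → if b then x else 0ℚ) (isN1-contract y z) (w-contract-≡ y z πz≡v)) absorb
    where
    absorb : (if isN1 D (π y) (π z) then w D (π y) (π z) + wt D (π y) u else 0ℚ)
             ≡ α-summand D (π y) (π z) + wt D (π y) u
    absorb with isN1 D (π y) (π z) in N1
    ... | true  = refl
    ... | false = begin
      0ℚ                ≡⟨ +-identityʳ 0ℚ ⟨
      0ℚ + 0ℚ           ≡⟨ cong (0ℚ +_) (wt-absorbed D absorbs ¬yv) ⟨
      0ℚ + wt D (π y) u ∎
      where
      open ≡-Reasoning
      ¬yv : arc D (π y) v ≡ false
      ¬yv = subst (λ t → arc D (π y) t ≡ false) πz≡v (isN1-false⇒¬arc D noLoops N1)

  β-summand-contract-≢ : ∀ y s → π s ≢ v → β-summand D′ y s ≤ β-summand D (π y) (π s)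
  β-summand-contract-≢ y s πs≢v = β-summand-lub D′ (0≤β-summand D _ _) λ z yzs →
    subst (_≤ β-summand D (π y) (π s))
          (sym (cong₂ _-_ (w-contract-≢ z s πs≢v) (wt-contract-≢ y s πs≢v)))
          (β-summand-≥ D (trans (sym (path2-contract y z s)) yzs))

  β-summand-contract-≡ : NonNegWeights D → Absorbs D u v → ∀ y s → π s ≡ v →
                         β-summand D′ y s ≤ β-summand D (π y) (π s) + β-summand D (π y) u
  β-summand-contract-≡ nonNeg absorbs y s πs≡v =
    β-summand-lub D′ (0≤+ (0≤β-summand D _ _) (0≤β-summand D _ _)) λ z yzs →
    let path = trans (sym (path2-contract y z s)) yzs in begin
      w D′ z s - wt D′ y s
        ≡⟨ cong₂ _-_ (w-contract-≡ z s πs≡v) (wt-contract-≡ absorbs y s πs≡v) ⟩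
      (w D (π z) (π s) + wt D (π z) u) - (wt D (π y) (π s) + wt D (π y) u)
        ≡⟨ +-‿-interchange (w D (π z) (π s)) _ _ _ ⟩
      (w D (π z) (π s) - wt D (π y) (π s)) + (wt D (π z) u - wt D (π y) u)
        ≤⟨ +-mono-≤ (β-summand-≥ D path)
                    (β-summand-≥-wt D nonNeg path (punchInᵢ≢i u z) (punchInᵢ≢i u y)) ⟩
      β-summand D (π y) (π s) + β-summand D (π y) u
        ∎
    where open ≤-Reasoning

  module _ (u≢v : u ≢ v) (y : Fin m) where

    private
      v′ : Fin m
      v′ = punchOut u≢v

      πv′≡v : π v′ ≡ v
      πv′≡v = punchIn-punchOut u≢v

      π≢v : ∀ j → j ≢ v′ → π j ≢ v
      π≢v j j≢v′ πj≡v = j≢v′ (punchIn-injective u j v′ (trans πj≡v (sym πv′≡v)))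

    αD-contract : NoLoops D → Absorbs D u v → αD D (π y) ≤ αD D′ y
    αD-contract noLoops absorbs = begin
      Σℚ (suc m) (α-summand D (π y))
        ≡⟨ Σℚ-punchIn m u (α-summand D (π y)) ⟩
      α-summand D (π y) u + Σℚ m (λ z → α-summand D (π y) (π z))
        ≡⟨ +-comm (α-summand D (π y) u) _ ⟩
      Σℚ m (λ z → α-summand D (π y) (π z)) + α-summand D (π y) u
        ≡⟨ cong (Σℚ m (λ z → α-summand D (π y) (π z)) +_) (α-summand-≢ D (punchInᵢ≢i u y)) ⟩
      Σℚ m (λ z → α-summand D (π y) (π z)) + wt D (π y) u
        ≤⟨ Σℚ-mono-except m v′ _ _ _ 0ℚ
             (≤-reflexive (sym (trans (+-identityʳ _)
                                      (α-summand-contract-≡ noLoops absorbs y v′ πv′≡v))))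
             (λ j j≢v′ → ≤-reflexive (sym (α-summand-contract-≢ y j (π≢v j j≢v′)))) ⟩
      Σℚ m (α-summand D′ y) + 0ℚ
        ≡⟨ +-identityʳ _ ⟩
      Σℚ m (α-summand D′ y)
        ∎
      where open ≤-Reasoning

    βD-contract : NonNegWeights D → Absorbs D u v → βD D′ y ≤ βD D (π y)
    βD-contract nonNeg absorbs = begin
      Σℚ m (β-summand D′ y)
        ≡⟨ +-identityʳ _ ⟨
      Σℚ m (β-summand D′ y) + 0ℚ
        ≤⟨ Σℚ-mono-except m v′ _ _ 0ℚ _
             (≤-trans (≤-reflexive (+-identityʳ _))
                      (β-summand-contract-≡ nonNeg absorbs y v′ πv′≡v))
             (λ j j≢v′ → β-summand-contract-≢ y j (π≢v j j≢v′)) ⟩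
      Σℚ m (λ s → β-summand D (π y) (π s)) + β-summand D (π y) u
        ≡⟨ +-comm _ (β-summand D (π y) u) ⟩
      β-summand D (π y) u + Σℚ m (λ s → β-summand D (π y) (π s))
        ≡⟨ Σℚ-punchIn m u (β-summand D (π y)) ⟨
      Σℚ (suc m) (β-summand D (π y))
        ∎
      where open ≤-Reasoning

lemma2 : (m : ℕ) (D : WDigraph (suc m)) → NoLoops D → NoTwoCycles D → NonNegWeights D
         → (u v : Fin (suc m)) → u ≢ v → Absorbs D u v
         → (y : Fin m) → δD (contract D u v) y ≤ δD D (punchIn u y)
lemma2 m D noLoops _ nonNeg u v u≢v absorbs y =
  +-mono-≤ (βD-contract u≢v y nonNeg absorbs) (neg-antimono-≤ (αD-contract u≢v y noLoops absorbs))
  where open Contraction D u v
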